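{- Let $G=(V,E)$ be a finite simple bipartite graph with bipartition $V_1,V_2$, and let $G'=(V',E')$ be obtained from $G$ by adding a new vertex $v_1$ adjacent to every vertex of $V_1$, and a new vertex $v_0$ adjacent only to $v_1$. Consider any execution of Algorithm ComputeAssignment on $(G',v_0)$. Then for every step $s$ of the execution, at the end of step $s$: (a) $P^s$ is a path in $G'$ (the empty sequence counting as a path) with $V(P^s)\subseteq R^s$; (b) $(\sigma^s,\tau^s)$ is a valid tuple for $(Q^s,R^s)$; (c) for $v\in Q^s$, if $\sigma^s(v)=u\in V'$ then $u\in N_{G'}(v)\cap Q^s$ and $\sigma^s(u)=\perp$; (d) for $v\in Q^s$, if $\sigma^s(v)=\perp$ then for every $u\in N_{G'}(v)\setminus V(P^s)$ we have $u\in Q^s$ and $\sigma^s(u)\neq\perp$.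
   Context: $N_{G'}(v)$ is the set of neighbours of $v$ in $G'$; for a sequence $P$ of vertices, $V(P)$ is its set of entries; the length of $P=p_0\ldots p_k$ is $k$ (the empty sequence has length $-1$). Algorithm ComputeAssignment$(G',v_0)$: initialize $\sigma(u)=\perp$ and $\tau(u)=\perp$ for all $u\in V'$ ($\perp$ a symbol not in $V'$), $R=\{v_0,v_1\}$, $P=v_0v_1$. While $P$ has length $\ge 1$: write $P=p_0p_1\ldots p_k$ and let $Z=\{u\in V'\setminus V(P): up_k\in E',\ \sigma(u)=\perp\}$. If $Z=\emptyset$: set $\sigma(p_{k-1})\leftarrow p_k$, $\sigma(p_k)\leftarrow\perp$, $\tau(p_k)\leftarrow p_{k-1}$, $\tau(p_{k-1})\leftarrow\perp$, and remove $p_k,p_{k-1}$ from the end of $P$. Otherwise: choose (arbitrarily) $z\in Z$, let $w=\tau(z)$, append $z$ to $P$, add $z$ to $R$, and if $w\neq\perp$ also append $w$ to $P$. When the loop ends, return $(R,\sigma)$. The iterations of the while loop are numbered $1,2,\ldots$; $P^s,R^s,\sigma^s,\tau^s$ denote the values of $P,R,\sigma,\tau$ at the end of iteration $s$, with $s=0$ referring to the initial values. Set $Q^s=R^s\setminus V(P^s)$. For $\sigma,\tau:V'\to V'\cup\{\perp\}$, a match of $(\sigma,\tau)$ is a pair $\{u,v\}\subseteq V'$ with $\sigma(u)=v$, $\tau(u)=\perp$, $\sigma(v)=\perp$, $\tau(v)=u$. The pair $(\sigma,\tau)$ is a valid tuple for $(Q,R)$ (with $Q,R\subseteq V'$) iff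 (1) for every $u\in V'$, if $\sigma(u)\neq\perp$ or $\tau(u)\neq\perp$ then $u\in R$; and (2) there are pairwise disjoint pairs $p_1,\ldots,p_m$ with $Q=\bigcup_{i=1}^m p_i$ and each $p_i$ a match of $(\sigma,\tau)$. -}

module Defs where

open import Data.Nat using (ℕ; zero; suc)
open import Data.Fin using (Fin)
import Data.Fin.Properties as FinP
open import Data.Bool using (Bool; true; false)
open import Data.Maybe using (Maybe; just; nothing)
open import Data.List using (List; []; _∷_; concatMap)
open import Data.List.Membership.Propositional using (_∈_)
open import Data.List.Relation.Unary.All using (All)
open import Data.List.Relation.Unary.Unique.Propositional using (Unique)
open import Data.List.Relation.Unary.Linked using (Linked)
open import Data.Product using (Σ; _×_; _,_; ∃)
open import Data.Sum using (_⊎_)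
open import Data.Empty using (⊥)
open import Data.Unit using (⊤)
open import Relation.Nullary using (¬_; Dec; yes; no)
open import Relation.Binary.PropositionalEquality using (_≡_; _≢_; refl; cong)
open import Level using (0ℓ)

-- The input graph G = (V , E) with V = Fin n: a finite simple bipartite
-- graph with bipartition V₁ = {x | side x ≡ true}, V₂ = {x | side x ≡ false}.

record BipGraph (n : ℕ) : Set₁ where
  field
    E      : Fin n → Fin n → Set
    sym    : ∀ {x y} → E x y → E y x
    irrefl : ∀ {x} → ¬ E x x
    side   : Fin n → Bool
    bip    : ∀ {x y} → E x y → side x ≢ side y

data Vx (n : ℕ) : Set where
  old : Fin n → Vx n
  v₀  : Vx n
  v₁  : Vx n

_≟V_ : ∀ {n} (x y : Vx n) → Dec (x ≡ y)
old a ≟V old b with a FinP.≟ b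
... | yes refl = yes refl
... | no a≢b = no λ { refl → a≢b refl }
old a ≟V v₀ = no λ ()
old a ≟V v₁ = no λ ()
v₀ ≟V old b = no λ ()
v₀ ≟V v₀ = yes refl
v₀ ≟V v₁ = no λ ()
v₁ ≟V old b = no λ ()
v₁ ≟V v₀ = no λ ()
v₁ ≟V v₁ = yes refl

Adj' : ∀ {n} → BipGraph n → Vx n → Vx n → Set
Adj' G (old a) (old b) = BipGraph.E G a b
Adj' G (old a) v₁      = BipGraph.side G a ≡ true
Adj' G v₁ (old b)      = BipGraph.side G b ≡ true
Adj' G v₀ v₁           = ⊤
Adj' G v₁ v₀           = ⊤
Adj' G _ _             = ⊥

-- State of Algorithm ComputeAssignment.  ⊥ (the "undefined" symbol) is
-- represented by nothing.  The sequence P = p₀ p₁ … p_k is stored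
-- REVERSED as the list  p_k ∷ p_{k-1} ∷ … ∷ p₀ ∷ [].

record State (n : ℕ) : Set where
  constructor st
  field
    σ  : Vx n → Maybe (Vx n)
    τ  : Vx n → Maybe (Vx n)
    R  : List (Vx n)
    rP : List (Vx n)
open State public

upd : ∀ {n} → (Vx n → Maybe (Vx n)) → Vx n → Maybe (Vx n) → Vx n → Maybe (Vx n)
upd f a b x with x ≟V a
... | yes _ = b
... | no  _ = f x

initState : ∀ {n} → State n
initState = st (λ _ → nothing) (λ _ → nothing) (v₀ ∷ v₁ ∷ []) (v₁ ∷ v₀ ∷ [])

InZ : ∀ {n} → BipGraph n → State n → Vx n → Vx n → Set
InZ G s pk u = ¬ (u ∈ rP s) × Adj' G u pk × σ s u ≡ nothing

extendP : ∀ {n} → Maybe (Vx n) → Vx n → List (Vx n) → List (Vx n)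
extendP nothing  z rp = z ∷ rp
extendP (just w) z rp = w ∷ z ∷ rp

-- One iteration of the while loop (only possible when P has length ≥ 1,
-- i.e. at least two entries).  The arbitrary choice of z is modelled by
-- nondeterminism: any z ∈ Z gives a step.
data Step {n} (G : BipGraph n) : State n → State n → Set where
  pop  : ∀ {σ τ R} pk pk₋₁ rest →
         (∀ u → ¬ InZ G (st σ τ R (pk ∷ pk₋₁ ∷ rest)) pk u) →
         Step G (st σ τ R (pk ∷ pk₋₁ ∷ rest))
                (st (upd (upd σ pk₋₁ (just pk)) pk nothing)
                    (upd (upd τ pk (just pk₋₁)) pk₋₁ nothing)
                    R rest)
  push : ∀ {σ τ R} pk pk₋₁ rest z →
         InZ G (st σ τ R (pk ∷ pk₋₁ ∷ rest)) pk z →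
         Step G (st σ τ R (pk ∷ pk₋₁ ∷ rest))
                (st σ τ (z ∷ R) (extendP (τ z) z (pk ∷ pk₋₁ ∷ rest)))

-- Run G s S : S is the state at the end of iteration s of some execution
-- of ComputeAssignment(G', v₀)  (s = 0: initial values).
data Run {n} (G : BipGraph n) : ℕ → State n → Set where
  start : Run G zero initState
  next  : ∀ {s S S'} → Run G s S → Step G S S' → Run G (suc s) S'

-- a path in G' : distinct entries, consecutive entries adjacent
-- (the empty sequence counts as a path).  Applied to the reversed list,
-- which is a path iff the original is (E' is symmetric).
IsPath : ∀ {n} → BipGraph n → List (Vx n) → Set
IsPath G xs = Unique xs × Linked (Adj' G) xs

InQ : ∀ {n} → State n → Vx n → Set
InQ S x = x ∈ R S × ¬ (x ∈ rP S)

MatchO : ∀ {n} → (Vx n → Maybe (Vx n)) → (Vx n → Maybe (Vx n)) → Vx n → Vx n → Set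
MatchO σ τ u v = σ u ≡ just v × τ u ≡ nothing × σ v ≡ nothing × τ v ≡ just u

IsMatch : ∀ {n} → (Vx n → Maybe (Vx n)) → (Vx n → Maybe (Vx n)) → Vx n × Vx n → Set
IsMatch σ τ (u , v) = MatchO σ τ u v ⊎ MatchO σ τ v u

pairElems : ∀ {n} → List (Vx n × Vx n) → List (Vx n)
pairElems = concatMap (λ { (u , v) → u ∷ v ∷ [] })

ValidTuple : ∀ {n} → (Vx n → Maybe (Vx n)) → (Vx n → Maybe (Vx n)) →
             (Vx n → Set) → List (Vx n) → Set
ValidTuple {n} σ τ Q R =
  (∀ u → (σ u ≢ nothing ⊎ τ u ≢ nothing) → u ∈ R) ×
  Σ (List (Vx n × Vx n)) λ ps →
      All (IsMatch σ τ) ps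
    × Unique (pairElems ps)
    × (∀ x → (Q x → x ∈ pairElems ps) × (x ∈ pairElems ps → Q x))

{-# OPTIONS --safe #-}
-- The four properties are strengthened to an invariant in which the matches
-- witnessing (b) are kept in an explicit list of pairs, each of which is an
-- edge of G'.  Property (c) is then a consequence of (b): a vertex of Q has a
-- unique partner in the list, and σ points to it.  A pop turns the last two
-- entries of P into a new match of Q; it preserves (d) because it only
-- happens when Z = ∅, i.e. when every neighbour of p_k off the path already
-- has σ defined.  A push of z (and of w = τ(z)) removes from Q exactly the
-- match {w , z}, if there is one, since σ(z) = ⊥ forces z to be its τ-end.
module Submission where

open import Defs
open import Data.Nat using (ℕ)
open import Data.Maybe using (Maybe; just; nothing)
open import Data.Maybe.Properties using (just-injective)
open import Data.List using (List; []; _∷_; filter)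
open import Data.List.Membership.Propositional using (_∈_; _∉_)
open import Data.List.Membership.Propositional.Properties using (∈-filter⁺; ∈-filter⁻)
open import Data.List.Relation.Unary.All as All using (All; []; _∷_)
open import Data.List.Relation.Unary.All.Properties using (¬Any⇒All¬; anti-mono; filter⁺)
open import Data.List.Relation.Unary.Any using (here; there)
open import Data.List.Relation.Unary.AllPairs as AllPairs using ([]; _∷_)
open import Data.List.Relation.Unary.Unique.Propositional using (Unique)
open import Data.List.Relation.Unary.Unique.Propositional.Properties using (Unique[x∷xs]⇒x∉xs)
open import Data.List.Relation.Unary.Linked as Linked using ([-]; _∷_)
open import Data.Product using (∃; _×_; _,_; proj₁; proj₂; uncurry; swap)
open import Data.Sum as Sum using (_⊎_; inj₁; inj₂)
open import Data.Empty using (⊥-elim)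
open import Data.Unit using (tt)
open import Data.Bool using (true; false)
open import Function using (_∘_)
open import Relation.Nullary using (¬_; yes; no; ¬?; does)
open import Relation.Nullary.Decidable using (_×-dec_)
open import Relation.Unary using (Decidable)
open import Relation.Binary.PropositionalEquality using (_≡_; _≢_; refl; sym; trans)

private
  variable
    n : ℕ
    a b u w x y z : Vx n
    ps : List (Vx n × Vx n)

nothing≢just : ∀ {A : Set} {x : A} → nothing ≢ just x
nothing≢just ()

upd-≡ : (f : Vx n → Maybe (Vx n)) (a : Vx n) (b : Maybe (Vx n)) → upd f a b a ≡ b
upd-≡ f a b with a ≟V a
... | yes _ = refl
... | no a≢a = ⊥-elim (a≢a refl)

upd-≢ : (f : Vx n → Maybe (Vx n)) (b : Maybe (Vx n)) → x ≢ a → upd f a b x ≡ f x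
upd-≢ {x = x} {a} f b x≢a with x ≟V a
... | yes x≡a = ⊥-elim (x≢a x≡a)
... | no _ = refl

three-way : (x a b : Vx n) → x ≡ a ⊎ x ≡ b ⊎ (x ≢ a × x ≢ b)
three-way x a b with x ≟V a | x ≟V b
... | yes x≡a | _ = inj₁ x≡a
... | no _ | yes x≡b = inj₂ (inj₁ x≡b)
... | no x≢a | no x≢b = inj₂ (inj₂ (x≢a , x≢b))

∉-∷∷ : ∀ {xs} → x ≢ a → x ≢ b → x ∉ xs → x ∉ a ∷ b ∷ xs
∉-∷∷ x≢a x≢b x∉xs (here x≡a) = x≢a x≡a
∉-∷∷ x≢a x≢b x∉xs (there (here x≡b)) = x≢b x≡b
∉-∷∷ x≢a x≢b x∉xs (there (there x∈xs)) = x∉xs x∈xs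

Adj'-sym : (G : BipGraph n) (x y : Vx n) → Adj' G x y → Adj' G y x
Adj'-sym G (old _) (old _) e = BipGraph.sym G e
Adj'-sym G (old _) v₁ e = e
Adj'-sym G v₁ (old _) e = e
Adj'-sym G v₀ v₁ e = tt
Adj'-sym G v₁ v₀ e = tt
Adj'-sym G (old _) v₀ ()
Adj'-sym G v₀ (old _) ()
Adj'-sym G v₀ v₀ ()
Adj'-sym G v₁ v₁ ()

Adj'-irrefl : (G : BipGraph n) → ¬ Adj' G x x
Adj'-irrefl {x = old _} G e = BipGraph.irrefl G e
Adj'-irrefl {x = v₀} G ()
Adj'-irrefl {x = v₁} G ()

module _ {σ τ : Vx n → Maybe (Vx n)} where

  IsMatch-swap : ∀ x y → IsMatch σ τ (x , y) → IsMatch σ τ (y , x)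
  IsMatch-swap _ _ = Sum.swap

  IsMatch-σ : IsMatch σ τ (x , y) → σ x ≡ just u → MatchO σ τ x y × u ≡ y
  IsMatch-σ (inj₁ m@(σx , _)) σx≡u = m , just-injective (trans (sym σx≡u) σx)
  IsMatch-σ (inj₂ (_ , _ , σx , _)) σx≡u = ⊥-elim (nothing≢just (trans (sym σx) σx≡u))

  IsMatch-τ : IsMatch σ τ (x , y) → τ x ≡ just u → MatchO σ τ y x × u ≡ y
  IsMatch-τ (inj₁ (_ , τx , _)) τx≡u = ⊥-elim (nothing≢just (trans (sym τx) τx≡u))
  IsMatch-τ (inj₂ m@(_ , _ , _ , τx)) τx≡u = m , just-injective (trans (sym τx≡u) τx)

  IsMatch-σ-nothing : IsMatch σ τ (x , y) → σ x ≡ nothing → τ x ≡ just y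
  IsMatch-σ-nothing (inj₁ (σx , _)) σx≡⊥ = ⊥-elim (nothing≢just (trans (sym σx≡⊥) σx))
  IsMatch-σ-nothing (inj₂ (_ , _ , _ , τx)) _ = τx

  IsMatch-resp : ∀ {σ' τ' : Vx n → Maybe (Vx n)} →
    σ' x ≡ σ x × τ' x ≡ τ x → σ' y ≡ σ y × τ' y ≡ τ y →
    IsMatch σ τ (x , y) → IsMatch σ' τ' (x , y)
  IsMatch-resp (σx , τx) (σy , τy) = Sum.map (resp σx τx σy τy) (resp σy τy σx τx)
    where
    resp : ∀ {σ' τ' : Vx n → Maybe (Vx n)} {u v} →
      σ' u ≡ σ u → τ' u ≡ τ u → σ' v ≡ σ v → τ' v ≡ τ v →
      MatchO σ τ u v → MatchO σ' τ' u v
    resp σu τu σv τv (m₁ , m₂ , m₃ , m₄) = trans σu m₁ , trans τu m₂ , trans σv m₃ , trans τv m₄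

Partner : List (Vx n × Vx n) → Vx n → Vx n → Set
Partner ps x y = (x , y) ∈ ps ⊎ (y , x) ∈ ps

Partner-sym : Partner ps x y → Partner ps y x
Partner-sym = Sum.swap

Partner-lookup : {P : Vx n × Vx n → Set} → (∀ a b → P (a , b) → P (b , a)) →
  All P ps → Partner ps x y → P (x , y)
Partner-lookup swap Ps (inj₁ xy∈) = All.lookup Ps xy∈
Partner-lookup swap Ps (inj₂ yx∈) = swap _ _ (All.lookup Ps yx∈)

∈-pairElems⁻ : ∀ ps → x ∈ pairElems ps → ∃ (Partner ps x)
∈-pairElems⁻ ((a , b) ∷ ps) (here refl) = b , inj₁ (here refl)
∈-pairElems⁻ ((a , b) ∷ ps) (there (here refl)) = a , inj₂ (here refl)
∈-pairElems⁻ (_ ∷ ps) (there (there x∈)) with ∈-pairElems⁻ ps x∈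
... | y , p = y , Sum.map there there p

∈-pairElems⁺ : Partner ps x y → x ∈ pairElems ps
∈-pairElems⁺ (inj₁ (here refl)) = here refl
∈-pairElems⁺ (inj₂ (here refl)) = there (here refl)
∈-pairElems⁺ (inj₁ (there xy∈)) = there (there (∈-pairElems⁺ (inj₁ xy∈)))
∈-pairElems⁺ (inj₂ (there yx∈)) = there (there (∈-pairElems⁺ (inj₂ yx∈)))

module _ {P : Vx n × Vx n → Set} (P? : Decidable P) where

  Partner-filter : ∀ ps → Partner (filter P? ps) x y → Partner ps x y
  Partner-filter _ = Sum.map (proj₁ ∘ ∈-filter⁻ P?) (proj₁ ∘ ∈-filter⁻ P?)

  pairElems-filter-⊆ : ∀ ps → x ∈ pairElems (filter P? ps) → x ∈ pairElems ps
  pairElems-filter-⊆ ps x∈ with ∈-pairElems⁻ (filter P? ps) x∈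
  ... | _ , p = ∈-pairElems⁺ (Partner-filter ps p)

  pairElems-filter-Unique : ∀ ps → Unique (pairElems ps) → Unique (pairElems (filter P? ps))
  pairElems-filter-Unique [] u = u
  pairElems-filter-Unique ((a , b) ∷ ps) ((a≢b ∷ a∉) ∷ b∉ ∷ u) with does (P? (a , b))
  ... | false = pairElems-filter-Unique ps u
  ... | true = (a≢b ∷ anti-mono (pairElems-filter-⊆ ps) a∉)
              ∷ anti-mono (pairElems-filter-⊆ ps) b∉ ∷ pairElems-filter-Unique ps u

Avoids : Vx n → Vx n × Vx n → Set
Avoids z (a , b) = a ≢ z × b ≢ z

avoids? : (z : Vx n) → Decidable (Avoids z)
avoids? z (a , b) = ¬? (a ≟V z) ×-dec ¬? (b ≟V z)

Partner-avoiding⁺ : Partner ps x y → x ≢ z → y ≢ z → Partner (filter (avoids? z) ps) x y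
Partner-avoiding⁺ {z = z} (inj₁ xy∈) x≢z y≢z = inj₁ (∈-filter⁺ (avoids? z) xy∈ (x≢z , y≢z))
Partner-avoiding⁺ {z = z} (inj₂ yx∈) x≢z y≢z = inj₂ (∈-filter⁺ (avoids? z) yx∈ (y≢z , x≢z))

Partner-avoiding⁻ : ∀ ps → Partner (filter (avoids? z) ps) x y → x ≢ z × y ≢ z
Partner-avoiding⁻ {z = z} ps (inj₁ xy∈) = proj₂ (∈-filter⁻ (avoids? z) {xs = ps} xy∈)
Partner-avoiding⁻ {z = z} ps (inj₂ yx∈) = swap (proj₂ (∈-filter⁻ (avoids? z) {xs = ps} yx∈))

∈-extendP-z : ∀ (mw : Maybe (Vx n)) {xs : List (Vx n)} → z ∈ extendP mw z xs
∈-extendP-z nothing = here refl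
∈-extendP-z (just _) = there (here refl)

∈-extendP-w : ∀ {mw : Maybe (Vx n)} {xs} → mw ≡ just w → w ∈ extendP mw z xs
∈-extendP-w refl = here refl

∈-extendP-there : ∀ (mw : Maybe (Vx n)) {xs : List (Vx n)} → x ∈ xs → x ∈ extendP mw z xs
∈-extendP-there nothing x∈ = there x∈
∈-extendP-there (just _) x∈ = there (there x∈)

∈-extendP⁻ : ∀ (mw : Maybe (Vx n)) {xs : List (Vx n)} → x ∈ extendP mw z xs → x ≡ z ⊎ mw ≡ just x ⊎ x ∈ xs
∈-extendP⁻ nothing (here x≡z) = inj₁ x≡z
∈-extendP⁻ nothing (there x∈) = inj₂ (inj₂ x∈)
∈-extendP⁻ (just _) (here refl) = inj₂ (inj₁ refl)
∈-extendP⁻ (just _) (there (here x≡z)) = inj₁ x≡z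
∈-extendP⁻ (just _) (there (there x∈)) = inj₂ (inj₂ x∈)

All-extendP : ∀ {P : Vx n → Set} (mw : Maybe (Vx n)) {xs : List (Vx n)} →
  P z → (∀ {w} → mw ≡ just w → P w) → All P xs → All P (extendP mw z xs)
All-extendP nothing Pz Pw Pxs = Pz ∷ Pxs
All-extendP (just _) Pz Pw Pxs = Pw refl ∷ Pz ∷ Pxs

IsPath-extendP : (G : BipGraph n) (mw : Maybe (Vx n)) {xs : List (Vx n)} →
  IsPath G (a ∷ xs) → z ∉ a ∷ xs → Adj' G z a →
  (∀ {w} → mw ≡ just w → w ∉ z ∷ a ∷ xs × Adj' G w z) →
  IsPath G (extendP mw z (a ∷ xs))
IsPath-extendP G nothing (uniq , linked) z∉ za _ = (¬Any⇒All¬ _ z∉ ∷ uniq) , (za ∷ linked)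
IsPath-extendP G (just _) (uniq , linked) z∉ za hw with hw refl
... | w∉ , wz = (¬Any⇒All¬ _ w∉ ∷ ¬Any⇒All¬ _ z∉ ∷ uniq) , (wz ∷ za ∷ linked)

module _ (G : BipGraph n) where

  record Invariant (S : State n) : Set where
    field
      path           : IsPath G (rP S)
      path⊆R         : All (_∈ R S) (rP S)
      support⊆R      : ∀ u → (σ S u ≢ nothing ⊎ τ S u ≢ nothing) → u ∈ R S
      pairs          : List (Vx n × Vx n)
      pairs-match    : All (IsMatch (σ S) (τ S)) pairs
      pairs-edge     : All (uncurry (Adj' G)) pairs
      pairs-disjoint : Unique (pairElems pairs)
      Q⊆pairs        : InQ S x → x ∈ pairElems pairs
      pairs⊆Q        : x ∈ pairElems pairs → InQ S x
      saturated      : ∀ v → InQ S v → σ S v ≡ nothing →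
                       ∀ u → Adj' G v u → u ∉ rP S → InQ S u × σ S u ≢ nothing

  module Partners {S : State n} (I : Invariant S) where
    open Invariant I

    partner : InQ S x → ∃ (Partner pairs x)
    partner q = ∈-pairElems⁻ pairs (Q⊆pairs q)

    partner-match : Partner pairs x y → IsMatch (σ S) (τ S) (x , y)
    partner-match = Partner-lookup IsMatch-swap pairs-match

    partner-edge : Partner pairs x y → Adj' G x y
    partner-edge = Partner-lookup (Adj'-sym G) pairs-edge

    partner-Q : Partner pairs x y → InQ S y
    partner-Q p = pairs⊆Q (∈-pairElems⁺ (Partner-sym p))

    σ-partner : InQ S x → σ S x ≡ just y → MatchO (σ S) (τ S) x y × Adj' G x y × InQ S y
    σ-partner q σx with partner q
    ... | _ , p with IsMatch-σ (partner-match p) σx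
    ...   | m , refl = m , partner-edge p , partner-Q p

    τ-partner : InQ S x → τ S x ≡ just y → MatchO (σ S) (τ S) y x × Adj' G y x × InQ S y
    τ-partner {x = x} q τx with partner q
    ... | _ , p with IsMatch-τ (partner-match p) τx
    ...   | m , refl = m , Adj'-sym G x _ (partner-edge p) , partner-Q p

  module Pop {σ₀ τ₀ : Vx n → Maybe (Vx n)} {R₀ : List (Vx n)} (pk pj : Vx n) (rest : List (Vx n))
    (noZ : ∀ u → ¬ InZ G (st σ₀ τ₀ R₀ (pk ∷ pj ∷ rest)) pk u)
    (I : Invariant (st σ₀ τ₀ R₀ (pk ∷ pj ∷ rest))) where

    S₀ S₁ : State n
    S₀ = st σ₀ τ₀ R₀ (pk ∷ pj ∷ rest)
    σ₁ τ₁ : Vx n → Maybe (Vx n)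
    σ₁ = upd (upd σ₀ pj (just pk)) pk nothing
    τ₁ = upd (upd τ₀ pk (just pj)) pj nothing
    S₁ = st σ₁ τ₁ R₀ rest

    open Invariant I
    open Partners I

    pk∉ : pk ∉ pj ∷ rest
    pk∉ = Unique[x∷xs]⇒x∉xs (proj₁ path)

    pj∉ : pj ∉ rest
    pj∉ = Unique[x∷xs]⇒x∉xs (AllPairs.tail (proj₁ path))

    σ₁-pk : σ₁ pk ≡ nothing
    σ₁-pk = upd-≡ _ pk nothing

    σ₁-pj : σ₁ pj ≡ just pk
    σ₁-pj = trans (upd-≢ _ nothing (pk∉ ∘ here ∘ sym)) (upd-≡ σ₀ pj (just pk))

    τ₁-pk : τ₁ pk ≡ just pj
    τ₁-pk = trans (upd-≢ _ nothing (pk∉ ∘ here)) (upd-≡ τ₀ pk (just pj))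

    τ₁-pj : τ₁ pj ≡ nothing
    τ₁-pj = upd-≡ _ pj nothing

    agree : x ≢ pk → x ≢ pj → σ₁ x ≡ σ₀ x × τ₁ x ≡ τ₀ x
    agree x≢pk x≢pj = trans (upd-≢ _ nothing x≢pk) (upd-≢ σ₀ _ x≢pj)
                    , trans (upd-≢ _ nothing x≢pj) (upd-≢ τ₀ _ x≢pk)

    Q₀-off-path : InQ S₀ x → x ≢ pk × x ≢ pj
    Q₀-off-path (_ , x∉) = x∉ ∘ here , x∉ ∘ there ∘ here

    agree-Q₀ : InQ S₀ x → σ₁ x ≡ σ₀ x × τ₁ x ≡ τ₀ x
    agree-Q₀ q = uncurry agree (Q₀-off-path q)

    Q₀⊆Q₁ : InQ S₀ x → InQ S₁ x
    Q₀⊆Q₁ (x∈R , x∉) = x∈R , x∉ ∘ there ∘ there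

    pk∈Q₁ : InQ S₁ pk
    pk∈Q₁ = All.head path⊆R , pk∉ ∘ there

    pj∈Q₁ : InQ S₁ pj
    pj∈Q₁ = All.head (All.tail path⊆R) , pj∉

    Q₁-cases : InQ S₁ x → x ≡ pk ⊎ x ≡ pj ⊎ InQ S₀ x
    Q₁-cases {x} (x∈R , x∉) = Sum.map₂ (Sum.map₂ λ (x≢pk , x≢pj) → x∈R , ∉-∷∷ x≢pk x≢pj x∉) (three-way x pk pj)

    Q₀-saturated⇒Q₁ : InQ S₀ u × σ₀ u ≢ nothing → InQ S₁ u × σ₁ u ≢ nothing
    Q₀-saturated⇒Q₁ (q , σu≢⊥) = Q₀⊆Q₁ q , σu≢⊥ ∘ trans (sym (proj₁ (agree-Q₀ q)))

    pj-saturated : InQ S₁ pj × σ₁ pj ≢ nothing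
    pj-saturated = pj∈Q₁ , λ σpj → nothing≢just (trans (sym σpj) σ₁-pj)

    saturated₁ : ∀ v → InQ S₁ v → σ₁ v ≡ nothing →
                 ∀ u → Adj' G v u → u ∉ rest → InQ S₁ u × σ₁ u ≢ nothing
    saturated₁ v q σv u vu u∉ with Q₁-cases q | three-way u pk pj
    ... | inj₂ (inj₁ refl) | _ = ⊥-elim (nothing≢just (trans (sym σv) σ₁-pj))
    ... | _ | inj₂ (inj₁ refl) = pj-saturated
    ... | inj₁ refl | inj₁ refl = ⊥-elim (Adj'-irrefl {x = pk} G vu)
    ... | inj₁ refl | inj₂ (inj₂ (u≢pk , u≢pj)) =
      let u∉P = ∉-∷∷ u≢pk u≢pj u∉
          σu≢⊥ = λ σu → noZ u (u∉P , Adj'-sym G pk u vu , σu)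
      in  Q₀-saturated⇒Q₁ ((support⊆R u (inj₁ σu≢⊥) , u∉P) , σu≢⊥)
    ... | inj₂ (inj₂ q₀) | inj₁ refl =
      ⊥-elim (noZ v (proj₂ q₀ , vu , trans (sym (proj₁ (agree-Q₀ q₀))) σv))
    ... | inj₂ (inj₂ q₀) | inj₂ (inj₂ (u≢pk , u≢pj)) =
      Q₀-saturated⇒Q₁ (saturated v q₀ (trans (sym (proj₁ (agree-Q₀ q₀))) σv) u vu (∉-∷∷ u≢pk u≢pj u∉))

    support⊆R₁ : ∀ u → (σ₁ u ≢ nothing ⊎ τ₁ u ≢ nothing) → u ∈ R₀
    support⊆R₁ u defined with three-way u pk pj
    ... | inj₁ refl = proj₁ pk∈Q₁
    ... | inj₂ (inj₁ refl) = proj₁ pj∈Q₁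
    ... | inj₂ (inj₂ (u≢pk , u≢pj)) =
      let σu , τu = agree u≢pk u≢pj
      in  support⊆R u (Sum.map (_∘ trans σu) (_∘ trans τu) defined)

    pairs₀-match₁ : All (IsMatch σ₁ τ₁) pairs
    pairs₀-match₁ = All.tabulate λ {(a , b)} ab∈ →
      IsMatch-resp {σ = σ₀} {τ₀} {σ' = σ₁} {τ₁} (agree-Q₀ (partner-Q (inj₂ ab∈))) (agree-Q₀ (partner-Q (inj₁ ab∈)))
                   (All.lookup pairs-match ab∈)

    pk∉pairs : pk ∉ pairElems pairs
    pk∉pairs pk∈ = proj₂ (pairs⊆Q pk∈) (here refl)

    pj∉pairs : pj ∉ pairElems pairs
    pj∉pairs pj∈ = proj₂ (pairs⊆Q pj∈) (there (here refl))

    Q₁⊆pairs₁ : InQ S₁ x → x ∈ pk ∷ pj ∷ pairElems pairs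
    Q₁⊆pairs₁ q with Q₁-cases q
    ... | inj₁ refl = here refl
    ... | inj₂ (inj₁ refl) = there (here refl)
    ... | inj₂ (inj₂ q₀) = there (there (Q⊆pairs q₀))

    pairs₁⊆Q₁ : x ∈ pk ∷ pj ∷ pairElems pairs → InQ S₁ x
    pairs₁⊆Q₁ (here refl) = pk∈Q₁
    pairs₁⊆Q₁ (there (here refl)) = pj∈Q₁
    pairs₁⊆Q₁ (there (there x∈)) = Q₀⊆Q₁ (pairs⊆Q x∈)

    invariant : Invariant S₁
    invariant = record
      { path           = AllPairs.tail (AllPairs.tail (proj₁ path)) , Linked.tail (Linked.tail (proj₂ path))
      ; path⊆R         = All.tail (All.tail path⊆R)
      ; support⊆R      = support⊆R₁
      ; pairs          = (pk , pj) ∷ pairs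
      ; pairs-match    = inj₂ (σ₁-pj , τ₁-pj , σ₁-pk , τ₁-pk) ∷ pairs₀-match₁
      ; pairs-edge     = Linked.head (proj₂ path) ∷ pairs-edge
      ; pairs-disjoint = (pk∉ ∘ here ∷ ¬Any⇒All¬ _ pk∉pairs)
                       ∷ ¬Any⇒All¬ _ pj∉pairs ∷ pairs-disjoint
      ; Q⊆pairs        = Q₁⊆pairs₁
      ; pairs⊆Q        = pairs₁⊆Q₁
      ; saturated      = saturated₁
      }

  module Push {σ₀ τ₀ : Vx n → Maybe (Vx n)} {R₀ : List (Vx n)} (pk pj : Vx n) (rest : List (Vx n))
    (z : Vx n) (z∈Z : InZ G (st σ₀ τ₀ R₀ (pk ∷ pj ∷ rest)) pk z)
    (I : Invariant (st σ₀ τ₀ R₀ (pk ∷ pj ∷ rest))) where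

    P₀ P₁ : List (Vx n)
    P₀ = pk ∷ pj ∷ rest
    P₁ = extendP (τ₀ z) z P₀
    S₀ S₁ : State n
    S₀ = st σ₀ τ₀ R₀ P₀
    S₁ = st σ₀ τ₀ (z ∷ R₀) P₁

    open Invariant I
    open Partners I

    z∉P₀ : z ∉ P₀
    z∉P₀ = proj₁ z∈Z

    σz : σ₀ z ≡ nothing
    σz = proj₂ (proj₂ z∈Z)

    τz-partner : τ₀ z ≡ just w → MatchO σ₀ τ₀ w z × Adj' G w z × InQ S₀ w
    τz-partner τz = τ-partner (support⊆R z (inj₂ λ τz⊥ → nothing≢just (trans (sym τz⊥) τz)) , z∉P₀) τz

    Q₁⇒Q₀ : InQ S₁ x → InQ S₀ x × x ≢ z × τ₀ z ≢ just x
    Q₁⇒Q₀ (here refl , x∉) = ⊥-elim (x∉ (∈-extendP-z (τ₀ z)))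
    Q₁⇒Q₀ (there x∈R , x∉) =
      (x∈R , x∉ ∘ ∈-extendP-there (τ₀ z)) , (λ { refl → x∉ (∈-extendP-z (τ₀ z)) }) , x∉ ∘ ∈-extendP-w

    Q₀⇒Q₁ : InQ S₀ x → x ≢ z → τ₀ z ≢ just x → InQ S₁ x
    Q₀⇒Q₁ (x∈R , x∉) x≢z τz≢x = there x∈R , Sum.[ x≢z , Sum.[ τz≢x , x∉ ] ] ∘ ∈-extendP⁻ (τ₀ z)

    pairs₁ : List (Vx n × Vx n)
    pairs₁ = filter (avoids? z) pairs

    Q₁⊆pairs₁ : InQ S₁ x → x ∈ pairElems pairs₁
    Q₁⊆pairs₁ {x} q with Q₁⇒Q₀ q
    ... | q₀ , x≢z , τz≢x with partner q₀
    ...   | y , p = ∈-pairElems⁺ (Partner-avoiding⁺ p x≢z y≢z)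
      where
      y≢z : y ≢ z
      y≢z refl = τz≢x (IsMatch-σ-nothing (IsMatch-swap x z (partner-match p)) σz)

    pairs₁⊆Q₁ : x ∈ pairElems pairs₁ → InQ S₁ x
    pairs₁⊆Q₁ {x} x∈ with ∈-pairElems⁻ pairs₁ x∈
    ... | y , p₁ with Partner-filter (avoids? z) pairs p₁ | Partner-avoiding⁻ pairs p₁
    ...   | p | x≢z , y≢z = Q₀⇒Q₁ (pairs⊆Q (∈-pairElems⁺ p)) x≢z τz≢x
      where
      τz≢x : τ₀ z ≢ just x
      τz≢x τz = y≢z (sym (proj₂ (IsMatch-σ (partner-match p) (proj₁ (proj₁ (τz-partner τz))))))

    saturated₁ : ∀ v → InQ S₁ v → σ₀ v ≡ nothing →
                 ∀ u → Adj' G v u → u ∉ P₁ → InQ S₁ u × σ₀ u ≢ nothing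
    saturated₁ v q σv u vu u∉ with saturated v (proj₁ (Q₁⇒Q₀ q)) σv u vu (u∉ ∘ ∈-extendP-there (τ₀ z))
    ... | q₀ , σu≢⊥ =
      Q₀⇒Q₁ q₀ (λ { refl → u∉ (∈-extendP-z (τ₀ z)) }) (u∉ ∘ ∈-extendP-w) , σu≢⊥

    w-extends-path : τ₀ z ≡ just w → w ∉ z ∷ P₀ × Adj' G w z
    w-extends-path τz with τz-partner τz
    ... | (σw , _) , wz , (_ , w∉P₀) =
      (λ { (here refl) → nothing≢just (trans (sym σz) σw) ; (there w∈P₀) → w∉P₀ w∈P₀ }) , wz

    invariant : Invariant S₁
    invariant = record
      { path           = IsPath-extendP G (τ₀ z) path z∉P₀ (proj₁ (proj₂ z∈Z)) w-extends-path
      ; path⊆R         = All-extendP (τ₀ z) (here refl) (there ∘ proj₁ ∘ proj₂ ∘ proj₂ ∘ τz-partner)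
                                     (All.map there path⊆R)
      ; support⊆R      = λ u → there ∘ support⊆R u
      ; pairs          = pairs₁
      ; pairs-match    = filter⁺ (avoids? z) pairs-match
      ; pairs-edge     = filter⁺ (avoids? z) pairs-edge
      ; pairs-disjoint = pairElems-filter-Unique (avoids? z) pairs pairs-disjoint
      ; Q⊆pairs        = Q₁⊆pairs₁
      ; pairs⊆Q        = pairs₁⊆Q₁
      ; saturated      = saturated₁
      }

  Q-initial-empty : ¬ InQ initState x
  Q-initial-empty (here refl , x∉) = x∉ (there (here refl))
  Q-initial-empty (there (here refl) , x∉) = x∉ (here refl)

  invariant-initial : Invariant initState
  invariant-initial = record
    { path           = ((λ ()) ∷ []) ∷ [] ∷ [] , tt ∷ [-]
    ; path⊆R         = there (here refl) ∷ here refl ∷ []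
    ; support⊆R      = λ _ → Sum.[ (λ σ≢⊥ → ⊥-elim (σ≢⊥ refl)) , (λ τ≢⊥ → ⊥-elim (τ≢⊥ refl)) ]
    ; pairs          = []
    ; pairs-match    = []
    ; pairs-edge     = []
    ; pairs-disjoint = []
    ; Q⊆pairs        = ⊥-elim ∘ Q-initial-empty
    ; pairs⊆Q        = λ ()
    ; saturated      = λ _ q → ⊥-elim (Q-initial-empty q)
    }

  invariant-step : ∀ {S S'} → Invariant S → Step G S S' → Invariant S'
  invariant-step I (pop pk pj rest noZ) = Pop.invariant pk pj rest noZ I
  invariant-step I (push pk pj rest z z∈Z) = Push.invariant pk pj rest z z∈Z I

  invariant-run : ∀ {s S} → Run G s S → Invariant S
  invariant-run start = invariant-initial
  invariant-run (next r step) = invariant-step (invariant-run r) step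

lemma1 : ∀ {n} (G : BipGraph n) (s : ℕ) (S : State n) → Run G s S →
    (IsPath G (rP S) × All (_∈ R S) (rP S))
    × ValidTuple (σ S) (τ S) (InQ S) (R S)
    × (∀ v → InQ S v → ∀ u → σ S v ≡ just u →
         Adj' G v u × InQ S u × σ S u ≡ nothing)
    × (∀ v → InQ S v → σ S v ≡ nothing →
         ∀ u → Adj' G v u → ¬ (u ∈ rP S) → InQ S u × σ S u ≢ nothing)
lemma1 G s S r =
    (path , path⊆R)
  , (support⊆R , pairs , pairs-match , pairs-disjoint , λ _ → Q⊆pairs , pairs⊆Q)
  , σ-matched
  , saturated
  where
  I = invariant-run G r
  open Invariant I
  open Partners G I

  σ-matched : ∀ v → InQ S v → ∀ u → σ S v ≡ just u → Adj' G v u × InQ S u × σ S u ≡ nothing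
  σ-matched v q u σv with σ-partner q σv
  ... | (_ , _ , σu , _) , vu , qu = vu , qu , σu
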